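{- Let $G$ be a finite simple graph, $A_1,A_2$ disjoint subsets of $V(G)$, and $G^*$ the graph obtained by toggling all pairs between $A_1$ and $A_2$, with closed neighborhood matrices $N$ and $N^*$. Suppose $A_1$ and $A_2$ are HO sets and $A_1\cup A_2$ is an AO set in $G$. Then for every pattern $\mathbf{p}$, $N^*\mathbf{p}=\mathbf{1}$ if and only if $N\mathbf{p}=\overline{\mathbf{x}_{A_1\cup A_2}}$ and $\mathbf{x}_{A_1}\cdot\mathbf{p}=\mathbf{x}_{A_2}\cdot\mathbf{p}=1$. Moreover, $A_1$ and $A_2$ are AO in $G^*$ and $\nu(G^*)=\nu(G)-1$.
   Context: For a graph $H$ with vertex set $V=\{v_1,\dots,v_n\}$, $N(H)$ is the closed neighborhood matrix over $\mathbb{Z}_2$ (entry $(i,j)$ is $1$ iff $i=j$ or $v_iv_j$ is an edge), $\nu(H)=\dim\ker N(H)$. Given disjoint $A_1,A_2\subseteq V(G)$, $G^*$ is obtained from $G$ by, for every $u\in A_1$, $v\in A_2$, adding the edge $uv$ if $u,v$ are non-adjacent and removing it if they are adjacent; $N=N(G)$, $N^*=N(G^*)$. Subsets $A$ are identified with characteristic vectors $\mathbf{x}_A$; $\mathbf{x}\cdot\mathbf{y}=\mathbf{x}^t\mathbf{y}$ over $\mathbb{Z}_2$; $\mathbf{1}$ is the all-ones vector, $\overline{\mathbf{x}}:=\mathbf{x}+\mathbf{1}$. In a graph $H$ with matrix $M$: a set $A$ is solvable if $M\mathbf{p}=\mathbf{x}_A$ has a solution; $A$ is HO if it is not solvable.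 For solvable $A$, $A$ is AO if $\mathbf{x}_A\cdot\mathbf{p}=1$ for all $\mathbf{p}$ with $M\mathbf{p}=\mathbf{1}$, and NO if $\mathbf{x}_A\cdot\mathbf{p}=0$ for all such $\mathbf{p}$ (such $\mathbf{p}$ always exist). -}

module Defs where

open import Data.Nat using (ℕ; zero; suc; _∸_; _≤_)
open import Data.Fin using (Fin; zero; suc; _≟_)
open import Data.Bool using (Bool; true; false; _∧_; _∨_; _xor_; not)
open import Data.Product using (Σ; _×_; ∃)
open import Relation.Nullary using (¬_; ⌊_⌋)
open import Relation.Binary.PropositionalEquality using (_≡_)

-- Vectors over Z₂ (true = 1, xor = +, ∧ = ·), indexed by vertices Fin n.
Vec₂ : ℕ → Set
Vec₂ n = Fin n → Bool

Mat₂ : ℕ → Set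
Mat₂ n = Fin n → Fin n → Bool

Σ₂ : (n : ℕ) → (Fin n → Bool) → Bool
Σ₂ zero    f = false
Σ₂ (suc n) f = f zero xor Σ₂ n (λ i → f (suc i))

_·_ : {n : ℕ} → Vec₂ n → Vec₂ n → Bool
_·_ {n} x y = Σ₂ n (λ i → x i ∧ y i)

_⊛_ : {n : ℕ} → Mat₂ n → Vec₂ n → Vec₂ n
_⊛_ {n} M p i = Σ₂ n (λ j → M i j ∧ p j)

_≐_ : {n : ℕ} → Vec₂ n → Vec₂ n → Set
x ≐ y = ∀ i → x i ≡ y i

𝟏 : {n : ℕ} → Vec₂ n
𝟏 _ = true

𝟎 : {n : ℕ} → Vec₂ n
𝟎 _ = false

‾_ : {n : ℕ} → Vec₂ n → Vec₂ n
(‾ x) i = x i xor true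

-- union of subsets (characteristic vectors)
_∪_ : {n : ℕ} → Vec₂ n → Vec₂ n → Vec₂ n
(A ∪ B) i = A i ∨ B i

Disjoint : {n : ℕ} → Vec₂ n → Vec₂ n → Set
Disjoint A B = ∀ i → A i ∧ B i ≡ false

record Graph (n : ℕ) : Set where
  field
    adj    : Fin n → Fin n → Bool
    sym    : ∀ i j → adj i j ≡ adj j i
    irrefl : ∀ i → adj i i ≡ false
open Graph public

Nmat : {n : ℕ} → (Fin n → Fin n → Bool) → Mat₂ n
Nmat adj i j = ⌊ i ≟ j ⌋ ∨ adj i j

N : {n : ℕ} → Graph n → Mat₂ n
N G = Nmat (adj G)

toggledAdj : {n : ℕ} → Graph n → Vec₂ n → Vec₂ n → Fin n → Fin n → Bool
toggledAdj G A₁ A₂ i j = adj G i j xor ((A₁ i ∧ A₂ j) ∨ (A₂ i ∧ A₁ j))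

N* : {n : ℕ} → Graph n → Vec₂ n → Vec₂ n → Mat₂ n
N* G A₁ A₂ = Nmat (toggledAdj G A₁ A₂)

Solvable : {n : ℕ} → Mat₂ n → Vec₂ n → Set
Solvable M A = ∃ λ p → (M ⊛ p) ≐ A

HO : {n : ℕ} → Mat₂ n → Vec₂ n → Set
HO M A = ¬ Solvable M A

AO : {n : ℕ} → Mat₂ n → Vec₂ n → Set
AO M A = Solvable M A × (∀ p → (M ⊛ p) ≐ 𝟏 → (A · p) ≡ true)

NO : {n : ℕ} → Mat₂ n → Vec₂ n → Set
NO M A = Solvable M A × (∀ p → (M ⊛ p) ≐ 𝟏 → (A · p) ≡ false)

lincomb : {n k : ℕ} → (Fin k → Vec₂ n) → Vec₂ k → Vec₂ n
lincomb {n} {k} b c i = Σ₂ k (λ j → c j ∧ b j i)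

IsKerBasis : {n k : ℕ} → Mat₂ n → (Fin k → Vec₂ n) → Set
IsKerBasis {n} {k} M b =
  (∀ j → (M ⊛ b j) ≐ 𝟎) ×
  (∀ (c : Vec₂ k) → lincomb b c ≐ 𝟎 → c ≐ 𝟎) ×
  (∀ v → (M ⊛ v) ≐ 𝟎 → ∃ λ (c : Vec₂ k) → lincomb b c ≐ v)

HasNullity : {n : ℕ} → Mat₂ n → ℕ → Set
HasNullity {n} M k = ∃ λ (b : Fin k → Vec₂ n) → IsKerBasis M b

{-# OPTIONS --safe #-}
-- N = N(G) is symmetric with unit diagonal, so xᵗNx = x · 𝟏 over Z₂. With the Fredholm
-- alternative this gives: a set A is HO iff A · k = 1 for some k ∈ ker N; 𝟏 is always
-- solvable, say N r = 𝟏; and, A₁ ∪ A₂ being AO, every k ∈ ker N has A₁ · k = A₂ · k while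
-- every solution of N v = A₁ ∪ A₂ has A₁ · v ≠ A₂ · v.
--
-- Toggling is the rank-two update N* = N + x_{A₁} x_{A₂}ᵗ + x_{A₂} x_{A₁}ᵗ, so
-- N* p = N p + (A₂ · p) A₁ + (A₁ · p) A₂. If N* p = c𝟏 then
-- N (p + c r) = (A₂ · p) A₁ + (A₁ · p) A₂, and since neither A₁ nor A₂ is solvable,
-- A₁ · p = A₂ · p =: s and N p = c𝟏 + s (A₁ ∪ A₂); the AO property then forces s = c.
-- This describes the 𝟏-patterns of G* (c = 1) and shows ker N* = ker N ∩ A₁^⊥ (c = 0),
-- a hyperplane of ker N because A₁ is HO. Solutions of N v = A₁ ∪ A₂ with A₁ · v = 1
-- (resp. 0) solve N* v = A₁ (resp. A₂).
module Submission where

open import Defs hiding (sym)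
open import Data.Nat using (ℕ; zero; suc; _∸_; _≤_; s≤s; z≤n)
open import Data.Bool using (Bool; true; false; _∧_; _∨_; _xor_; not) renaming (_≟_ to _≟ᵇ_)
open import Data.Bool.Properties
  using (∧-comm; ∧-idem; ∧-identityʳ; ∧-zeroʳ; ∧-conicalʳ; ∧-distribˡ-xor; ∧-distribʳ-xor;
         xor-assoc; xor-comm; xor-same; xor-identityʳ; xor-∧-commutativeRing; true-xor; ¬-not)
open import Data.Maybe using (just; nothing)
open import Data.Fin using (Fin; zero; suc; _≟_; punchIn)
open import Data.Fin.Properties using (punchInᵢ≢i; any?)
open import Data.Vec.Functional using (_∷_; insertAt; removeAt)
open import Data.Vec.Functional.Properties using (insertAt-lookup; insertAt-punchIn; insertAt-removeAt)
open import Data.Product as Product using (_×_; _,_; ∃; proj₁; proj₂)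
open import Data.Sum as Sum using (_⊎_; inj₁; inj₂)
open import Function.Base using (id)
open import Function.Bundles using (_⇔_; mk⇔; Equivalence)
open import Relation.Nullary using (yes; no; contradiction; ⌊_⌋)
open import Relation.Nullary.Decidable using (isYes≗does; dec-true; dec-false)
open import Relation.Binary.PropositionalEquality
  using (_≡_; _≢_; refl; sym; trans; cong; cong₂; module ≡-Reasoning)
open import Tactic.RingSolver using (solve-∀)
open import Tactic.RingSolver.Core.AlmostCommutativeRing using (AlmostCommutativeRing; fromCommutativeRing)

open ≡-Reasoning

-- The ring solver does not know x xor x ≡ false or x ∧ x ≡ x; those steps are done by hand.
Z₂ : AlmostCommutativeRing _ _
Z₂ = fromCommutativeRing xor-∧-commutativeRing λ { false → just refl ; true → nothing }

xor-cancelʳ : ∀ x y → (x xor y) xor y ≡ x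
xor-cancelʳ x y = begin
  (x xor y) xor y  ≡⟨ xor-assoc x y y ⟩
  x xor (y xor y)  ≡⟨ cong (x xor_) (xor-same y) ⟩
  x xor false      ≡⟨ xor-identityʳ x ⟩
  x                ∎

xor-cancelˡ : ∀ x y → (x xor y) xor x ≡ y
xor-cancelˡ x y = trans (cong (_xor x) (xor-comm x y)) (xor-cancelʳ y x)

xor-move : ∀ {x y z} → x xor y ≡ z → x ≡ z xor y
xor-move {x} {y} refl = sym (xor-cancelʳ x y)

xor-interchange : ∀ a b c d → (a xor b) xor (c xor d) ≡ (a xor c) xor (b xor d)
xor-interchange = solve-∀ Z₂

xor-left-comm : ∀ a b c → a xor (b xor c) ≡ b xor (a xor c)
xor-left-comm = solve-∀ Z₂

∧-left-comm : ∀ a b c → a ∧ (b ∧ c) ≡ b ∧ (a ∧ c)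
∧-left-comm = solve-∀ Z₂

∧-swap-outer : ∀ a b c → a ∧ (b ∧ c) ≡ c ∧ (b ∧ a)
∧-swap-outer = solve-∀ Z₂

∨≡xor : ∀ x y → x ∧ y ≡ false → x ∨ y ≡ x xor y
∨≡xor false y _ = refl
∨≡xor true false _ = refl

infixl 21 _⊕_
infixr 22 _⋆_

_⊕_ : {n : ℕ} → Vec₂ n → Vec₂ n → Vec₂ n
(x ⊕ y) i = x i xor y i

_⋆_ : {n : ℕ} → Bool → Vec₂ n → Vec₂ n
(c ⋆ x) i = c ∧ x i

𝐞 : {n : ℕ} → Fin n → Vec₂ n
𝐞 r i = ⌊ i ≟ r ⌋

⌊≟⌋-refl : ∀ {n} (i : Fin n) → ⌊ i ≟ i ⌋ ≡ true
⌊≟⌋-refl i = trans (isYes≗does (i ≟ i)) (dec-true (i ≟ i) refl)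

⌊≟⌋-≢ : ∀ {n} {i j : Fin n} → i ≢ j → ⌊ i ≟ j ⌋ ≡ false
⌊≟⌋-≢ {i = i} {j} i≢j = trans (isYes≗does (i ≟ j)) (dec-false (i ≟ j) i≢j)

⌊≟⌋-sym : ∀ {n} (i j : Fin n) → ⌊ i ≟ j ⌋ ≡ ⌊ j ≟ i ⌋
⌊≟⌋-sym i j with i ≟ j | j ≟ i
... | yes _   | yes _   = refl
... | no _    | no _    = refl
... | yes i≡j | no j≢i  = contradiction (sym i≡j) j≢i
... | no i≢j  | yes j≡i = contradiction (sym j≡i) i≢j

Σ₂-cong : ∀ n {f g : Fin n → Bool} → (∀ i → f i ≡ g i) → Σ₂ n f ≡ Σ₂ n g
Σ₂-cong zero    f≗g = refl
Σ₂-cong (suc n) f≗g = cong₂ _xor_ (f≗g zero) (Σ₂-cong n (λ i → f≗g (suc i)))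

Σ₂-false : ∀ n {f : Fin n → Bool} → (∀ i → f i ≡ false) → Σ₂ n f ≡ false
Σ₂-false zero    f≗0 = refl
Σ₂-false (suc n) f≗0 = cong₂ _xor_ (f≗0 zero) (Σ₂-false n (λ i → f≗0 (suc i)))

Σ₂-xor : ∀ n (f g : Fin n → Bool) → Σ₂ n (λ i → f i xor g i) ≡ Σ₂ n f xor Σ₂ n g
Σ₂-xor zero    f g = refl
Σ₂-xor (suc n) f g = begin
  (f zero xor g zero) xor Σ₂ n (λ i → f (suc i) xor g (suc i))
    ≡⟨ cong ((f zero xor g zero) xor_) (Σ₂-xor n (λ i → f (suc i)) (λ i → g (suc i))) ⟩
  (f zero xor g zero) xor (Σ₂ n (λ i → f (suc i)) xor Σ₂ n (λ i → g (suc i)))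
    ≡⟨ xor-interchange (f zero) (g zero) _ _ ⟩
  (f zero xor Σ₂ n (λ i → f (suc i))) xor (g zero xor Σ₂ n (λ i → g (suc i))) ∎

Σ₂-∧ˡ : ∀ n c (f : Fin n → Bool) → Σ₂ n (λ i → c ∧ f i) ≡ c ∧ Σ₂ n f
Σ₂-∧ˡ zero    c f = sym (∧-zeroʳ c)
Σ₂-∧ˡ (suc n) c f = trans (cong ((c ∧ f zero) xor_) (Σ₂-∧ˡ n c (λ i → f (suc i))))
                          (sym (∧-distribˡ-xor c (f zero) _))

Σ₂-∧ʳ : ∀ n c (f : Fin n → Bool) → Σ₂ n (λ i → f i ∧ c) ≡ Σ₂ n f ∧ c
Σ₂-∧ʳ n c f =
  trans (Σ₂-cong n (λ i → ∧-comm (f i) c)) (trans (Σ₂-∧ˡ n c f) (∧-comm c (Σ₂ n f)))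

Σ₂-swap : ∀ m n (f : Fin m → Fin n → Bool) →
  Σ₂ m (λ i → Σ₂ n (f i)) ≡ Σ₂ n (λ j → Σ₂ m (λ i → f i j))
Σ₂-swap zero    n f = sym (Σ₂-false n (λ _ → refl))
Σ₂-swap (suc m) n f = trans (cong (Σ₂ n (f zero) xor_) (Σ₂-swap m n (λ i → f (suc i))))
                            (sym (Σ₂-xor n (f zero) _))

Σ₂-punchIn : ∀ n (r : Fin (suc n)) (f : Fin (suc n) → Bool) →
  Σ₂ (suc n) f ≡ f r xor Σ₂ n (λ j → f (punchIn r j))
Σ₂-punchIn n       zero    f = refl
Σ₂-punchIn (suc n) (suc r) f = begin
  f zero xor Σ₂ (suc n) (λ i → f (suc i))
    ≡⟨ cong (f zero xor_) (Σ₂-punchIn n r (λ i → f (suc i))) ⟩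
  f zero xor (f (suc r) xor Σ₂ n (λ j → f (suc (punchIn r j))))
    ≡⟨ xor-left-comm (f zero) (f (suc r)) _ ⟩
  f (suc r) xor (f zero xor Σ₂ n (λ j → f (suc (punchIn r j)))) ∎

Σ₂-true⇒∃ : ∀ n (f : Fin n → Bool) → Σ₂ n f ≡ true → ∃ λ i → f i ≡ true
Σ₂-true⇒∃ n f Σf≡true with any? (λ i → f i ≟ᵇ true)
... | yes witness = witness
... | no none     =
  contradiction (trans (sym Σf≡true) (Σ₂-false n (λ i → ¬-not (λ fi → none (i , fi))))) λ ()

-- Off-diagonal terms of a symmetric double sum cancel in pairs.
Σ₂-symmetric : ∀ n (f : Fin n → Fin n → Bool) → (∀ i j → f i j ≡ f j i) →
  Σ₂ n (λ i → Σ₂ n (f i)) ≡ Σ₂ n (λ i → f i i)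
Σ₂-symmetric zero    f f-sym = refl
Σ₂-symmetric (suc n) f f-sym = begin
  (f₀₀ xor row) xor Σ₂ n (λ i → f (suc i) zero xor inner i)
    ≡⟨ cong ((f₀₀ xor row) xor_) (Σ₂-xor n (λ i → f (suc i) zero) inner) ⟩
  (f₀₀ xor row) xor (column xor Σ₂ n inner)
    ≡⟨ cong₂ (λ c s → (f₀₀ xor row) xor (c xor s))
             (Σ₂-cong n (λ i → f-sym (suc i) zero))
             (Σ₂-symmetric n (λ i j → f (suc i) (suc j)) (λ i j → f-sym (suc i) (suc j))) ⟩
  (f₀₀ xor row) xor (row xor diagonal)
    ≡⟨ sym (xor-assoc (f₀₀ xor row) row diagonal) ⟩
  ((f₀₀ xor row) xor row) xor diagonal
    ≡⟨ cong (_xor diagonal) (xor-cancelʳ f₀₀ row) ⟩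
  f₀₀ xor diagonal ∎
  where
  f₀₀      = f zero zero
  row      = Σ₂ n (λ j → f zero (suc j))
  column   = Σ₂ n (λ i → f (suc i) zero)
  inner    = λ i → Σ₂ n (λ j → f (suc i) (suc j))
  diagonal = Σ₂ n (λ i → f (suc i) (suc i))

·-comm : ∀ {n} (a b : Vec₂ n) → a · b ≡ b · a
·-comm {n} a b = Σ₂-cong n (λ i → ∧-comm (a i) (b i))

·-congˡ : ∀ {n} {a b : Vec₂ n} (p : Vec₂ n) → a ≐ b → a · p ≡ b · p
·-congˡ {n} p a≐b = Σ₂-cong n (λ i → cong (_∧ p i) (a≐b i))

·-congʳ : ∀ {n} (a : Vec₂ n) {p q : Vec₂ n} → p ≐ q → a · p ≡ a · q
·-congʳ {n} a p≐q = Σ₂-cong n (λ i → cong (a i ∧_) (p≐q i))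

·-⊕ʳ : ∀ {n} (a p q : Vec₂ n) → a · (p ⊕ q) ≡ a · p xor a · q
·-⊕ʳ {n} a p q = trans (Σ₂-cong n (λ i → ∧-distribˡ-xor (a i) (p i) (q i))) (Σ₂-xor n _ _)

·-⊕ˡ : ∀ {n} (a b p : Vec₂ n) → (a ⊕ b) · p ≡ a · p xor b · p
·-⊕ˡ {n} a b p = trans (Σ₂-cong n (λ i → ∧-distribʳ-xor (p i) (a i) (b i))) (Σ₂-xor n _ _)


·-⋆ʳ : ∀ {n} (a : Vec₂ n) c (p : Vec₂ n) → a · (c ⋆ p) ≡ c ∧ a · p
·-⋆ʳ {n} a c p = trans (Σ₂-cong n (λ i → ∧-left-comm (a i) c (p i))) (Σ₂-∧ˡ n c _)

·-⋆ˡ : ∀ {n} c (a p : Vec₂ n) → (c ⋆ a) · p ≡ c ∧ a · p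
·-⋆ˡ {n} c a p = trans (·-comm (c ⋆ a) p) (trans (·-⋆ʳ p c a) (cong (c ∧_) (·-comm p a)))

·-𝟎ʳ : ∀ {n} (a : Vec₂ n) → a · 𝟎 ≡ false
·-𝟎ʳ {n} a = Σ₂-false n (λ i → ∧-zeroʳ (a i))

·-𝐞ʳ : ∀ {n} (a : Vec₂ n) (r : Fin n) → a · 𝐞 r ≡ a r
·-𝐞ʳ {suc n} a r = begin
  a · 𝐞 r
    ≡⟨ Σ₂-punchIn n r (λ i → a i ∧ 𝐞 r i) ⟩
  a r ∧ ⌊ r ≟ r ⌋ xor Σ₂ n (λ j → a (punchIn r j) ∧ ⌊ punchIn r j ≟ r ⌋)
    ≡⟨ cong₂ (λ d s → a r ∧ d xor s) (⌊≟⌋-refl r)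
             (Σ₂-false n (λ j → trans (cong (a (punchIn r j) ∧_) (⌊≟⌋-≢ (punchInᵢ≢i r j)))
                                      (∧-zeroʳ _))) ⟩
  a r ∧ true xor false
    ≡⟨ trans (xor-identityʳ _) (∧-identityʳ (a r)) ⟩
  a r ∎

lincomb-cong : ∀ {n k} (b : Fin k → Vec₂ n) {c d : Vec₂ k} → c ≐ d → lincomb b c ≐ lincomb b d
lincomb-cong {k = k} b c≐d i = Σ₂-cong k (λ j → cong (_∧ b j i) (c≐d j))

·-lincomb : ∀ {n k} (a : Vec₂ n) (b : Fin k → Vec₂ n) (c : Vec₂ k) →
  a · lincomb b c ≡ c · (λ j → a · b j)
·-lincomb {n} {k} a b c = begin
  Σ₂ n (λ i → a i ∧ Σ₂ k (λ j → c j ∧ b j i))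
    ≡⟨ Σ₂-cong n (λ i → sym (Σ₂-∧ˡ k (a i) _)) ⟩
  Σ₂ n (λ i → Σ₂ k (λ j → a i ∧ (c j ∧ b j i)))
    ≡⟨ Σ₂-swap n k _ ⟩
  Σ₂ k (λ j → Σ₂ n (λ i → a i ∧ (c j ∧ b j i)))
    ≡⟨ Σ₂-cong k (λ j → ·-⋆ʳ a (c j) (b j)) ⟩
  Σ₂ k (λ j → c j ∧ a · b j) ∎

infixr 22 _*ᵥ_
infixl 23 _ᵀ

_*ᵥ_ : ∀ {m n} → (Fin m → Fin n → Bool) → Vec₂ n → Vec₂ m
(M *ᵥ p) i = M i · p

_ᵀ : ∀ {m n} → (Fin m → Fin n → Bool) → Fin n → Fin m → Bool
(M ᵀ) j i = M i j

*ᵥ-⊕ : ∀ {m n} (M : Fin m → Fin n → Bool) (p q : Vec₂ n) →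
  (M *ᵥ (p ⊕ q)) ≐ (M *ᵥ p ⊕ M *ᵥ q)
*ᵥ-⊕ M p q i = ·-⊕ʳ (M i) p q

*ᵥ-⋆ : ∀ {m n} (M : Fin m → Fin n → Bool) c (p : Vec₂ n) →
  (M *ᵥ (c ⋆ p)) ≐ (c ⋆ M *ᵥ p)
*ᵥ-⋆ M c p i = ·-⋆ʳ (M i) c p

·-*ᵥ-transpose : ∀ {m n} (M : Fin m → Fin n → Bool) (x : Vec₂ n) (y : Vec₂ m) →
  (M *ᵥ x) · y ≡ x · (M ᵀ *ᵥ y)
·-*ᵥ-transpose {m} {n} M x y = begin
  (M *ᵥ x) · y
    ≡⟨ ·-comm (M *ᵥ x) y ⟩
  Σ₂ m (λ i → y i ∧ Σ₂ n (λ j → M i j ∧ x j))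
    ≡⟨ Σ₂-cong m (λ i → sym (Σ₂-∧ˡ n (y i) _)) ⟩
  Σ₂ m (λ i → Σ₂ n (λ j → y i ∧ (M i j ∧ x j)))
    ≡⟨ Σ₂-swap m n _ ⟩
  Σ₂ n (λ j → Σ₂ m (λ i → y i ∧ (M i j ∧ x j)))
    ≡⟨ Σ₂-cong n (λ j → Σ₂-cong m (λ i → ∧-swap-outer (y i) (M i j) (x j))) ⟩
  Σ₂ n (λ j → Σ₂ m (λ i → x j ∧ (M i j ∧ y i)))
    ≡⟨ Σ₂-cong n (λ j → Σ₂-∧ˡ m (x j) _) ⟩
  x · (M ᵀ *ᵥ y) ∎

module FirstColumn {m n : ℕ} (M : Fin m → Fin (suc n) → Bool) where

  column : Vec₂ m
  column i = M i zero

  rest : Fin m → Fin n → Bool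
  rest i j = M i (suc j)

  zeroColumn-solution : ∀ {a p} → (rest *ᵥ p) ≐ a → (M *ᵥ (false ∷ p)) ≐ a
  zeroColumn-solution {p = p} rest-p≐a i =
    trans (cong (_xor (rest *ᵥ p) i) (∧-zeroʳ (column i))) (rest-p≐a i)

  zeroColumn-obstruction : (∀ i → column i ≡ false) →
    ∀ {y} → (rest ᵀ *ᵥ y) ≐ 𝟎 → (M ᵀ *ᵥ y) ≐ 𝟎
  zeroColumn-obstruction column≡0 {y} _ zero =
    Σ₂-false m (λ i → cong (_∧ y i) (column≡0 i))
  zeroColumn-obstruction column≡0 rest-y≐0 (suc j) = rest-y≐0 j

  module Pivot (r : Fin m) (pivot : column r ≡ true) where

    reduced : Fin m → Fin n → Bool
    reduced i = rest i ⊕ column i ⋆ rest r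

    reducedTarget : Vec₂ m → Vec₂ m
    reducedTarget a = a ⊕ a r ⋆ column

    reduced-*ᵥ : ∀ p i → (reduced *ᵥ p) i ≡ (rest *ᵥ p) i xor column i ∧ (rest *ᵥ p) r
    reduced-*ᵥ p i = trans (·-⊕ˡ (rest i) (column i ⋆ rest r) p)
                           (cong ((rest *ᵥ p) i xor_) (·-⋆ˡ (column i) (rest r) p))

    reduced-ᵀ*ᵥ : ∀ y j → (reduced ᵀ *ᵥ y) j ≡ (rest ᵀ *ᵥ y) j xor column · y ∧ rest r j
    reduced-ᵀ*ᵥ y j = begin
      (reduced ᵀ *ᵥ y) j
        ≡⟨ ·-congˡ y (λ i → cong (rest i j xor_) (∧-comm (column i) (rest r j))) ⟩
      ((rest ᵀ) j ⊕ rest r j ⋆ column) · y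
        ≡⟨ ·-⊕ˡ ((rest ᵀ) j) (rest r j ⋆ column) y ⟩
      (rest ᵀ *ᵥ y) j xor (rest r j ⋆ column) · y
        ≡⟨ cong ((rest ᵀ *ᵥ y) j xor_)
                (trans (·-⋆ˡ (rest r j) column y) (∧-comm (rest r j) (column · y))) ⟩
      (rest ᵀ *ᵥ y) j xor column · y ∧ rest r j ∎

    pivot-solution : ∀ {a p} → (reduced *ᵥ p) ≐ reducedTarget a →
      (M *ᵥ ((a r xor (rest *ᵥ p) r) ∷ p)) ≐ a
    pivot-solution {a} {p} reduced-p≐ i = begin
      column i ∧ (a r xor (rest *ᵥ p) r) xor (rest *ᵥ p) i
        ≡⟨ rearrange (column i) (a r) ((rest *ᵥ p) r) ((rest *ᵥ p) i) ⟩
      ((rest *ᵥ p) i xor column i ∧ (rest *ᵥ p) r) xor column i ∧ a r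
        ≡⟨ cong (_xor column i ∧ a r) (trans (sym (reduced-*ᵥ p i)) (reduced-p≐ i)) ⟩
      (a i xor a r ∧ column i) xor column i ∧ a r
        ≡⟨ cong (λ t → (a i xor t) xor column i ∧ a r) (∧-comm (a r) (column i)) ⟩
      (a i xor column i ∧ a r) xor column i ∧ a r
        ≡⟨ xor-cancelʳ (a i) _ ⟩
      a i ∎
      where
      rearrange : ∀ c x R X → c ∧ (x xor R) xor X ≡ (X xor c ∧ R) xor c ∧ x
      rearrange = solve-∀ Z₂

    -- Undo the row operation: add (column · y) times the pivot row.
    pivot-obstruction : ∀ {a y} → (reduced ᵀ *ᵥ y) ≐ 𝟎 → y · reducedTarget a ≡ true →
      let y′ = y ⊕ (column · y) ⋆ 𝐞 r in ((M ᵀ *ᵥ y′) ≐ 𝟎) × (y′ · a ≡ true)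
    pivot-obstruction {a} {y} reduced-y≐0 y·a′ = obstruction , dot
      where
      cy = column · y

      ⊕-pivotRow : ∀ v → (y ⊕ cy ⋆ 𝐞 r) · v ≡ y · v xor cy ∧ v r
      ⊕-pivotRow v = trans (·-⊕ˡ y (cy ⋆ 𝐞 r) v)
        (cong (y · v xor_) (trans (·-⋆ˡ cy (𝐞 r) v)
                                  (cong (cy ∧_) (trans (·-comm (𝐞 r) v) (·-𝐞ʳ v r)))))

      obstruction : (M ᵀ *ᵥ (y ⊕ cy ⋆ 𝐞 r)) ≐ 𝟎
      obstruction zero = begin
        column · (y ⊕ cy ⋆ 𝐞 r)       ≡⟨ ·-comm column _ ⟩
        (y ⊕ cy ⋆ 𝐞 r) · column       ≡⟨ ⊕-pivotRow column ⟩
        y · column xor cy ∧ column r  ≡⟨ cong₂ (λ u v → u xor cy ∧ v) (·-comm y column) pivot ⟩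
        cy xor cy ∧ true              ≡⟨ cong (cy xor_) (∧-identityʳ cy) ⟩
        cy xor cy                     ≡⟨ xor-same cy ⟩
        false                         ∎
      obstruction (suc j) = begin
        (rest ᵀ) j · (y ⊕ cy ⋆ 𝐞 r)          ≡⟨ ·-comm ((rest ᵀ) j) _ ⟩
        (y ⊕ cy ⋆ 𝐞 r) · (rest ᵀ) j          ≡⟨ ⊕-pivotRow ((rest ᵀ) j) ⟩
        y · (rest ᵀ) j xor cy ∧ rest r j     ≡⟨ cong (_xor cy ∧ rest r j) (·-comm y ((rest ᵀ) j)) ⟩
        (rest ᵀ *ᵥ y) j xor cy ∧ rest r j    ≡⟨ sym (reduced-ᵀ*ᵥ y j) ⟩
        (reduced ᵀ *ᵥ y) j                   ≡⟨ reduced-y≐0 j ⟩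
        false ∎

      dot : (y ⊕ cy ⋆ 𝐞 r) · a ≡ true
      dot = begin
        (y ⊕ cy ⋆ 𝐞 r) · a
          ≡⟨ ⊕-pivotRow a ⟩
        y · a xor cy ∧ a r
          ≡⟨ cong (y · a xor_) (trans (cong (_∧ a r) (·-comm column y)) (∧-comm _ (a r))) ⟩
        y · a xor a r ∧ y · column
          ≡⟨ cong (y · a xor_) (sym (·-⋆ʳ y (a r) column)) ⟩
        y · a xor y · (a r ⋆ column)
          ≡⟨ sym (·-⊕ʳ y a (a r ⋆ column)) ⟩
        y · reducedTarget a
          ≡⟨ y·a′ ⟩
        true ∎

-- Fredholm alternative, by elimination on the first column.
solvable⊎obstructed : ∀ {m} n (M : Fin m → Fin n → Bool) (a : Vec₂ m) →
  (∃ λ p → (M *ᵥ p) ≐ a) ⊎ (∃ λ y → ((M ᵀ *ᵥ y) ≐ 𝟎) × (y · a ≡ true))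
solvable⊎obstructed zero M a with any? (λ i → a i ≟ᵇ true)
... | yes (r , aᵣ) = inj₂ (𝐞 r , (λ ()) , trans (·-comm (𝐞 r) a) (trans (·-𝐞ʳ a r) aᵣ))
... | no a≢𝟎       = inj₁ ((λ ()) , λ i → sym (¬-not (λ aᵢ → a≢𝟎 (i , aᵢ))))
solvable⊎obstructed (suc n) M a with any? (λ i → M i zero ≟ᵇ true)
... | no column≢𝟎 = Sum.map (λ (p , p-sol) → false ∷ p , zeroColumn-solution p-sol)
                           (λ (y , y-ker , y·a) → y , zeroColumn-obstruction column≡0 y-ker , y·a)
                           (solvable⊎obstructed n rest a)
  where
  open FirstColumn M
  column≡0 : ∀ i → column i ≡ false
  column≡0 i = ¬-not (λ cᵢ → column≢𝟎 (i , cᵢ))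
... | yes (r , pivot) = Sum.map (λ (p , p-sol) → (a r xor (rest *ᵥ p) r) ∷ p , pivot-solution p-sol)
                                (λ (y , y-ker , y·a) → _ , pivot-obstruction {a} y-ker y·a)
                                (solvable⊎obstructed n reduced (reducedTarget a))
  where open FirstColumn M; open Pivot r pivot

Symmetric : {n : ℕ} → Mat₂ n → Set
Symmetric M = ∀ i j → M i j ≡ M j i

UnitDiagonal : {n : ℕ} → Mat₂ n → Set
UnitDiagonal M = ∀ i → M i i ≡ true

module _ {n : ℕ} {M : Mat₂ n} (M-sym : Symmetric M) where

  transpose-symmetric : ∀ y → (M ᵀ *ᵥ y) ≐ (M ⊛ y)
  transpose-symmetric y i = ·-congˡ y (λ k → M-sym k i)

  ⊛-selfAdjoint : ∀ x y → (M ⊛ x) · y ≡ x · (M ⊛ y)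
  ⊛-selfAdjoint x y = trans (·-*ᵥ-transpose M x y) (·-congʳ x (transpose-symmetric y))

  -- xᵗMx = Σᵢ Mᵢᵢ xᵢ² over Z₂, and xᵢ² = xᵢ.
  ·-⊛-self : UnitDiagonal M → ∀ x → x · (M ⊛ x) ≡ x · 𝟏
  ·-⊛-self M-diag x = begin
    Σ₂ n (λ i → x i ∧ Σ₂ n (λ j → M i j ∧ x j))
      ≡⟨ Σ₂-cong n (λ i → sym (Σ₂-∧ˡ n (x i) _)) ⟩
    Σ₂ n (λ i → Σ₂ n (λ j → x i ∧ (M i j ∧ x j)))
      ≡⟨ Σ₂-symmetric n _ summand-sym ⟩
    Σ₂ n (λ i → x i ∧ (M i i ∧ x i))
      ≡⟨ Σ₂-cong n (λ i → trans (cong (λ d → x i ∧ (d ∧ x i)) (M-diag i))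
                                (trans (∧-idem (x i)) (sym (∧-identityʳ (x i))))) ⟩
    x · 𝟏 ∎
    where
    summand-sym : ∀ i j → x i ∧ (M i j ∧ x j) ≡ x j ∧ (M j i ∧ x i)
    summand-sym i j =
      trans (cong (λ d → x i ∧ (d ∧ x j)) (M-sym i j)) (∧-swap-outer (x i) (M j i) (x j))

  solvable⊎kernelWitness : ∀ a → Solvable M a ⊎ (∃ λ k → ((M ⊛ k) ≐ 𝟎) × (a · k ≡ true))
  solvable⊎kernelWitness a =
    Sum.map₂ (λ (y , y-ker , y·a) → y , (λ i → trans (sym (transpose-symmetric y i)) (y-ker i)) ,
                                        trans (·-comm a y) y·a)
             (solvable⊎obstructed n M a)

  HO⇒kernelWitness : ∀ {a} → HO M a → ∃ λ k → ((M ⊛ k) ≐ 𝟎) × (a · k ≡ true)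
  HO⇒kernelWitness {a} ho =
    Sum.[ (λ a-solvable → contradiction a-solvable ho) , id ] (solvable⊎kernelWitness a)

  -- Sutner's theorem: kernel vectors k satisfy k · 𝟏 = kᵗMk = 0.
  𝟏-solvable : UnitDiagonal M → Solvable M 𝟏
  𝟏-solvable M-diag =
    Sum.[ id , (λ (k , k-ker , 𝟏·k≡true) →
                 contradiction (trans (sym 𝟏·k≡true) (trans (·-comm 𝟏 k) (k·𝟏≡false k k-ker))) λ ()) ]
         (solvable⊎kernelWitness 𝟏)
    where
    k·𝟏≡false : ∀ k → (M ⊛ k) ≐ 𝟎 → k · 𝟏 ≡ false
    k·𝟏≡false k k-ker = begin
      k · 𝟏        ≡⟨ sym (·-⊛-self M-diag k) ⟩
      k · (M ⊛ k)  ≡⟨ ·-congʳ k k-ker ⟩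
      k · 𝟎        ≡⟨ ·-𝟎ʳ k ⟩
      false        ∎

-- IsKerBasis M b unfolds to IsBasis (λ v → (M ⊛ v) ≐ 𝟎) b.
IsBasis : {n k : ℕ} → (Vec₂ n → Set) → (Fin k → Vec₂ n) → Set
IsBasis {n} {k} P b =
  (∀ j → P (b j)) ×
  (∀ (c : Vec₂ k) → lincomb b c ≐ 𝟎 → c ≐ 𝟎) ×
  (∀ v → P v → ∃ λ (c : Vec₂ k) → lincomb b c ≐ v)

IsBasis-cong : ∀ {n k} {P Q : Vec₂ n → Set} {b : Fin k → Vec₂ n} →
  (∀ v → P v ⇔ Q v) → IsBasis P b → IsBasis Q b
IsBasis-cong P⇔Q (in-P , independent , spanning) =
  (λ j → Equivalence.to (P⇔Q _) (in-P j)) , independent ,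
  λ v Qv → spanning v (Equivalence.from (P⇔Q v) Qv)

basis-witness : ∀ {n k} {P : Vec₂ n → Set} {b : Fin k → Vec₂ n} → IsBasis P b →
  ∀ {a v} → P v → a · v ≡ true → ∃ λ j → a · b j ≡ true
basis-witness {k = k} {b = b} (_ , _ , spanning) {a} {v} Pv a·v =
  let c , c≐v = spanning v Pv
      c·ab≡true = trans (sym (·-lincomb a b c)) (trans (·-congʳ a c≐v) a·v)
      j , cⱼ∧a·bⱼ = Σ₂-true⇒∃ k (λ j → c j ∧ a · b j) c·ab≡true
  in j , ∧-conicalʳ (c j) (a · b j) cⱼ∧a·bⱼ

-- Sliding every other basis vector along b j₀ clears its a-coordinate.
module KernelHyperplane {n k : ℕ} {M : Mat₂ n} {b : Fin (suc k) → Vec₂ n} (basis : IsKerBasis M b)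
  (a : Vec₂ n) (j₀ : Fin (suc k)) (a·bⱼ₀ : a · b j₀ ≡ true) where

  φ : Fin k → Bool
  φ t = a · b (punchIn j₀ t)

  reduced : Fin k → Vec₂ n
  reduced t = b (punchIn j₀ t) ⊕ φ t ⋆ b j₀

  lincomb-reduced : ∀ c → lincomb reduced c ≐ lincomb b (insertAt c j₀ (c · φ))
  lincomb-reduced c i = begin
    Σ₂ k (λ t → c t ∧ (b (punchIn j₀ t) i xor φ t ∧ b j₀ i))
      ≡⟨ Σ₂-cong k (λ t → distrib (c t) (b (punchIn j₀ t) i) (φ t) (b j₀ i)) ⟩
    Σ₂ k (λ t → c t ∧ b (punchIn j₀ t) i xor (c t ∧ φ t) ∧ b j₀ i)
      ≡⟨ Σ₂-xor k _ _ ⟩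
    Σ₂ k (λ t → c t ∧ b (punchIn j₀ t) i) xor Σ₂ k (λ t → (c t ∧ φ t) ∧ b j₀ i)
      ≡⟨ cong (Σ₂ k (λ t → c t ∧ b (punchIn j₀ t) i) xor_) (Σ₂-∧ʳ k (b j₀ i) _) ⟩
    Σ₂ k (λ t → c t ∧ b (punchIn j₀ t) i) xor (c · φ) ∧ b j₀ i
      ≡⟨ xor-comm (Σ₂ k (λ t → c t ∧ b (punchIn j₀ t) i)) _ ⟩
    (c · φ) ∧ b j₀ i xor Σ₂ k (λ t → c t ∧ b (punchIn j₀ t) i)
      ≡⟨ sym (cong₂ _xor_ (cong (_∧ b j₀ i) (insertAt-lookup c j₀ (c · φ)))
                          (Σ₂-cong k (λ t → cong (_∧ b (punchIn j₀ t) i)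
                                                 (insertAt-punchIn c j₀ (c · φ) t)))) ⟩
    c′ j₀ ∧ b j₀ i xor Σ₂ k (λ t → c′ (punchIn j₀ t) ∧ b (punchIn j₀ t) i)
      ≡⟨ sym (Σ₂-punchIn k j₀ (λ l → c′ l ∧ b l i)) ⟩
    lincomb b c′ i ∎
    where
    c′ = insertAt c j₀ (c · φ)
    distrib : ∀ x y z w → x ∧ (y xor z ∧ w) ≡ x ∧ y xor (x ∧ z) ∧ w
    distrib = solve-∀ Z₂

  reduced-basis : IsBasis (λ v → ((M ⊛ v) ≐ 𝟎) × (a · v ≡ false)) reduced
  reduced-basis = in-hyperplane , independent , spanning
    where
    b-ker = proj₁ basis
    b-independent = proj₁ (proj₂ basis)
    b-spanning = proj₂ (proj₂ basis)

    in-hyperplane : ∀ t → ((M ⊛ reduced t) ≐ 𝟎) × (a · reduced t ≡ false)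
    in-hyperplane t = kernel , orthogonal
      where
      kernel : (M ⊛ reduced t) ≐ 𝟎
      kernel i = begin
        (M ⊛ reduced t) i
          ≡⟨ *ᵥ-⊕ M (b (punchIn j₀ t)) (φ t ⋆ b j₀) i ⟩
        (M ⊛ b (punchIn j₀ t)) i xor (M *ᵥ (φ t ⋆ b j₀)) i
          ≡⟨ cong₂ _xor_ (b-ker (punchIn j₀ t) i) (*ᵥ-⋆ M (φ t) (b j₀) i) ⟩
        false xor φ t ∧ (M ⊛ b j₀) i
          ≡⟨ trans (cong (φ t ∧_) (b-ker j₀ i)) (∧-zeroʳ (φ t)) ⟩
        false ∎
      orthogonal : a · reduced t ≡ false
      orthogonal = begin
        a · reduced t               ≡⟨ ·-⊕ʳ a (b (punchIn j₀ t)) (φ t ⋆ b j₀) ⟩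
        φ t xor a · (φ t ⋆ b j₀)    ≡⟨ cong (φ t xor_) (·-⋆ʳ a (φ t) (b j₀)) ⟩
        φ t xor φ t ∧ a · b j₀      ≡⟨ cong (λ x → φ t xor φ t ∧ x) a·bⱼ₀ ⟩
        φ t xor φ t ∧ true          ≡⟨ trans (cong (φ t xor_) (∧-identityʳ (φ t))) (xor-same (φ t)) ⟩
        false ∎

    independent : ∀ c → lincomb reduced c ≐ 𝟎 → c ≐ 𝟎
    independent c c-trivial t =
      trans (sym (insertAt-punchIn c j₀ (c · φ) t))
            (b-independent (insertAt c j₀ (c · φ))
                           (λ i → trans (sym (lincomb-reduced c i)) (c-trivial i)) (punchIn j₀ t))

    spanning : ∀ v → ((M ⊛ v) ≐ 𝟎) × (a · v ≡ false) → ∃ λ c → lincomb reduced c ≐ v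
    spanning v (v-ker , a·v) = removeAt C j₀ , λ i →
        trans (lincomb-reduced (removeAt C j₀) i) (trans (lincomb-cong b restored i) (C≐v i))
      where
      C = proj₁ (b-spanning v v-ker)
      C≐v = proj₂ (b-spanning v v-ker)
      a·v-expanded : C j₀ xor removeAt C j₀ · φ ≡ false
      a·v-expanded = begin
        C j₀ xor removeAt C j₀ · φ
          ≡⟨ cong (_xor removeAt C j₀ · φ) (sym (∧-identityʳ (C j₀))) ⟩
        C j₀ ∧ true xor removeAt C j₀ · φ
          ≡⟨ cong (λ x → C j₀ ∧ x xor removeAt C j₀ · φ) (sym a·bⱼ₀) ⟩
        C j₀ ∧ a · b j₀ xor removeAt C j₀ · φ
          ≡⟨ sym (Σ₂-punchIn k j₀ (λ l → C l ∧ a · b l)) ⟩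
        C · (λ l → a · b l)   ≡⟨ sym (·-lincomb a b C) ⟩
        a · lincomb b C       ≡⟨ ·-congʳ a C≐v ⟩
        a · v                 ≡⟨ a·v ⟩
        false                 ∎
      restored : insertAt (removeAt C j₀) j₀ (removeAt C j₀ · φ) ≐ C
      restored l = trans (cong (λ x → insertAt (removeAt C j₀) j₀ x l) (sym (xor-move a·v-expanded)))
                         (insertAt-removeAt C j₀ l)

module Toggle {n : ℕ} {M M* : Mat₂ n} (M-sym : Symmetric M) (M-diag : UnitDiagonal M)
  {A₁ A₂ : Vec₂ n} (disjoint : Disjoint A₁ A₂)
  (ho₁ : HO M A₁) (ho₂ : HO M A₂) (ao : AO M (A₁ ∪ A₂))
  (M*-entry : ∀ i j → M* i j ≡ M i j xor (A₁ i ∧ A₂ j xor A₂ i ∧ A₁ j)) where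

  M*-⊛ : ∀ p → (M* ⊛ p) ≐ ((M ⊛ p) ⊕ ((A₂ · p) ⋆ A₁ ⊕ (A₁ · p) ⋆ A₂))
  M*-⊛ p i = begin
    M* i · p
      ≡⟨ ·-congˡ p (M*-entry i) ⟩
    (M i ⊕ (A₁ i ⋆ A₂ ⊕ A₂ i ⋆ A₁)) · p
      ≡⟨ trans (·-⊕ˡ (M i) _ p) (cong (M i · p xor_) (·-⊕ˡ (A₁ i ⋆ A₂) (A₂ i ⋆ A₁) p)) ⟩
    M i · p xor ((A₁ i ⋆ A₂) · p xor (A₂ i ⋆ A₁) · p)
      ≡⟨ cong (M i · p xor_) (cong₂ _xor_ (trans (·-⋆ˡ (A₁ i) A₂ p) (∧-comm (A₁ i) _))
                                          (trans (·-⋆ˡ (A₂ i) A₁ p) (∧-comm (A₂ i) _))) ⟩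
    M i · p xor ((A₂ · p) ∧ A₁ i xor (A₁ · p) ∧ A₂ i) ∎

  ∪≐⊕ : (A₁ ∪ A₂) ≐ (A₁ ⊕ A₂)
  ∪≐⊕ i = ∨≡xor (A₁ i) (A₂ i) (disjoint i)

  ∪-· : ∀ p → (A₁ ∪ A₂) · p ≡ A₁ · p xor A₂ · p
  ∪-· p = trans (·-congˡ p ∪≐⊕) (·-⊕ˡ A₁ A₂ p)

  M*-⊛-balanced : ∀ {p s} → A₁ · p ≡ s → A₂ · p ≡ s →
    (M* ⊛ p) ≐ ((M ⊛ p) ⊕ s ⋆ (A₁ ∪ A₂))
  M*-⊛-balanced {p} {s} refl t≡s i = trans (M*-⊛ p i) (cong ((M ⊛ p) i xor_) (begin
    (A₂ · p) ∧ A₁ i xor s ∧ A₂ i  ≡⟨ cong (λ t → t ∧ A₁ i xor s ∧ A₂ i) t≡s ⟩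
    s ∧ A₁ i xor s ∧ A₂ i        ≡⟨ sym (∧-distribˡ-xor s (A₁ i) (A₂ i)) ⟩
    s ∧ (A₁ i xor A₂ i)          ≡⟨ cong (s ∧_) (sym (∪≐⊕ i)) ⟩
    s ∧ (A₁ ∪ A₂) i              ∎))

  private
    q = proj₁ (proj₁ ao)
    q-sol = proj₂ (proj₁ ao)
    r = proj₁ (𝟏-solvable M-sym M-diag)
    r-sol = proj₂ (𝟏-solvable M-sym M-diag)
    k₁ = proj₁ (HO⇒kernelWitness M-sym ho₁)
    k₁-ker = proj₁ (proj₂ (HO⇒kernelWitness M-sym ho₁))
    A₁·k₁ = proj₂ (proj₂ (HO⇒kernelWitness M-sym ho₁))

  kernel⇒dots-equal : ∀ {k} → (M ⊛ k) ≐ 𝟎 → A₁ · k ≡ A₂ · k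
  kernel⇒dots-equal {k} k-ker = xor-move (begin
    A₁ · k xor A₂ · k  ≡⟨ sym (∪-· k) ⟩
    (A₁ ∪ A₂) · k      ≡⟨ ·-congˡ k (λ i → sym (q-sol i)) ⟩
    (M ⊛ q) · k        ≡⟨ ⊛-selfAdjoint M-sym q k ⟩
    q · (M ⊛ k)        ≡⟨ ·-congʳ q k-ker ⟩
    q · 𝟎              ≡⟨ ·-𝟎ʳ q ⟩
    false              ∎)

  solution⇒dots-differ : ∀ {v} → (M ⊛ v) ≐ (A₁ ∪ A₂) → A₁ · v xor A₂ · v ≡ true
  solution⇒dots-differ {v} v-sol = begin
    A₁ · v xor A₂ · v  ≡⟨ sym (∪-· v) ⟩
    (A₁ ∪ A₂) · v      ≡⟨ ·-congˡ v (λ i → sym (v-sol i)) ⟩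
    (M ⊛ v) · v        ≡⟨ ·-comm (M ⊛ v) v ⟩
    v · (M ⊛ v)        ≡⟨ ·-⊛-self M-sym M-diag v ⟩
    v · 𝟏              ≡⟨ sym (·-congʳ v r-sol) ⟩
    v · (M ⊛ r)        ≡⟨ sym (⊛-selfAdjoint M-sym v r) ⟩
    (M ⊛ v) · r        ≡⟨ ·-congˡ r v-sol ⟩
    (A₁ ∪ A₂) · r      ≡⟨ proj₂ ao r r-sol ⟩
    true               ∎

  combination-solvable⇒coefficients≡ : ∀ {α β} → Solvable M (α ⋆ A₁ ⊕ β ⋆ A₂) → α ≡ β
  combination-solvable⇒coefficients≡ {false} {false} _           = refl
  combination-solvable⇒coefficients≡ {true}  {true}  _           = refl
  combination-solvable⇒coefficients≡ {true}  {false} (p , p-sol) =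
    contradiction (p , λ i → trans (p-sol i) (xor-identityʳ (A₁ i))) ho₁
  combination-solvable⇒coefficients≡ {false} {true}  (p , p-sol) = contradiction (p , p-sol) ho₂

  -- M (p + c r) = (A₂·p) A₁ + (A₁·p) A₂, where M r = 𝟏.
  M*-constant⇒dots-equal : ∀ c {p} → (M* ⊛ p) ≐ (c ⋆ 𝟏) → A₁ · p ≡ A₂ · p
  M*-constant⇒dots-equal c {p} M*p≐c𝟏 =
    sym (combination-solvable⇒coefficients≡ (p ⊕ c ⋆ r , shifted))
    where
    shifted : (M ⊛ (p ⊕ c ⋆ r)) ≐ ((A₂ · p) ⋆ A₁ ⊕ (A₁ · p) ⋆ A₂)
    shifted i = begin
      (M ⊛ (p ⊕ c ⋆ r)) i
        ≡⟨ trans (*ᵥ-⊕ M p (c ⋆ r) i) (cong ((M ⊛ p) i xor_) (*ᵥ-⋆ M c r i)) ⟩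
      (M ⊛ p) i xor c ∧ (M ⊛ r) i
        ≡⟨ cong₂ (λ u w → u xor c ∧ w)
                 (xor-move {x = (M ⊛ p) i} (trans (sym (M*-⊛ p i)) (M*p≐c𝟏 i))) (r-sol i) ⟩
      (c ∧ true xor ((A₂ · p) ∧ A₁ i xor (A₁ · p) ∧ A₂ i)) xor c ∧ true
        ≡⟨ xor-cancelˡ (c ∧ true) _ ⟩
      (A₂ · p) ∧ A₁ i xor (A₁ · p) ∧ A₂ i ∎

  balanced-image⇒dot : ∀ c s {p} → A₁ · p ≡ s → A₂ · p ≡ s →
    (M ⊛ p) ≐ (c ⋆ 𝟏 ⊕ s ⋆ (A₁ ∪ A₂)) → s ≡ c
  balanced-image⇒dot false false _ _ _ = refl
  balanced-image⇒dot true  true  _ _ _ = refl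
  balanced-image⇒dot true  false {p} s≡false t≡false Mp≐𝟏 = contradiction (begin
    false              ≡⟨ sym (cong₂ _xor_ s≡false t≡false) ⟩
    A₁ · p xor A₂ · p  ≡⟨ sym (∪-· p) ⟩
    (A₁ ∪ A₂) · p      ≡⟨ proj₂ ao p Mp≐𝟏 ⟩
    true               ∎) λ ()
  balanced-image⇒dot false true s≡true t≡true Mp≐A₁∪A₂ =
    contradiction (trans (sym (cong₂ _xor_ s≡true t≡true)) (solution⇒dots-differ Mp≐A₁∪A₂)) λ ()

  M*-constant-image : ∀ c {p} → ((M* ⊛ p) ≐ (c ⋆ 𝟏)) ⇔
    (((M ⊛ p) ≐ (c ⋆ (‾ (A₁ ∪ A₂)))) × (A₁ · p ≡ c) × (A₂ · p ≡ c))
  M*-constant-image c {p} = mk⇔ to from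
    where
    to : (M* ⊛ p) ≐ (c ⋆ 𝟏) →
      ((M ⊛ p) ≐ (c ⋆ (‾ (A₁ ∪ A₂)))) × (A₁ · p ≡ c) × (A₂ · p ≡ c)
    to M*p≐c𝟏 = Mp≐c‾U , s≡c , trans t≡s s≡c
      where
      t≡s = sym (M*-constant⇒dots-equal c M*p≐c𝟏)
      Mp≐ : (M ⊛ p) ≐ (c ⋆ 𝟏 ⊕ (A₁ · p) ⋆ (A₁ ∪ A₂))
      Mp≐ i = xor-move (trans (sym (M*-⊛-balanced refl t≡s i)) (M*p≐c𝟏 i))
      s≡c = balanced-image⇒dot c (A₁ · p) refl t≡s Mp≐
      Mp≐c‾U : (M ⊛ p) ≐ (c ⋆ (‾ (A₁ ∪ A₂)))
      Mp≐c‾U i = trans (Mp≐ i) (trans (cong (λ s → c ∧ true xor s ∧ (A₁ ∪ A₂) i) s≡c)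
                                      (trans (sym (∧-distribˡ-xor c true ((A₁ ∪ A₂) i)))
                                             (cong (c ∧_) (xor-comm true ((A₁ ∪ A₂) i)))))
    from : ((M ⊛ p) ≐ (c ⋆ (‾ (A₁ ∪ A₂)))) × (A₁ · p ≡ c) × (A₂ · p ≡ c) →
      (M* ⊛ p) ≐ (c ⋆ 𝟏)
    from (Mp≐c‾U , s≡c , t≡c) i = begin
      (M* ⊛ p) i                  ≡⟨ M*-⊛-balanced s≡c t≡c i ⟩
      (M ⊛ p) i xor c ∧ u         ≡⟨ cong (_xor c ∧ u) (Mp≐c‾U i) ⟩
      c ∧ (u xor true) xor c ∧ u  ≡⟨ sym (∧-distribˡ-xor c (u xor true) u) ⟩
      c ∧ ((u xor true) xor u)    ≡⟨ cong (c ∧_) (xor-cancelˡ u true) ⟩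
      c ∧ true                    ∎
      where
      u = (A₁ ∪ A₂) i

  toggled-kernel : ∀ v → (((M ⊛ v) ≐ 𝟎) × (A₁ · v ≡ false)) ⇔ ((M* ⊛ v) ≐ 𝟎)
  toggled-kernel v = mk⇔
    (λ (v-ker , s≡false) → from (v-ker , s≡false , trans (sym (kernel⇒dots-equal v-ker)) s≡false))
    (λ M*v≐𝟎 → let Mv≐𝟎 , s≡false , _ = to M*v≐𝟎 in Mv≐𝟎 , s≡false)
    where open Equivalence (M*-constant-image false {v})

  -- q solves Mq = A₁ ∪ A₂, and adding k₁ ∈ ker M flips both A₁·q and A₂·q.
  solution-with-A₁-dot : ∀ α → ∃ λ p → ((M ⊛ p) ≐ (A₁ ∪ A₂)) × (A₁ · p ≡ α)
  solution-with-A₁-dot α with A₁ · q ≟ᵇ α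
  ... | yes A₁·q≡α = q , q-sol , A₁·q≡α
  ... | no  A₁·q≢α = q ⊕ k₁ , shifted-sol , (begin
    A₁ · (q ⊕ k₁)       ≡⟨ ·-⊕ʳ A₁ q k₁ ⟩
    A₁ · q xor A₁ · k₁  ≡⟨ cong (A₁ · q xor_) A₁·k₁ ⟩
    A₁ · q xor true     ≡⟨ trans (xor-comm (A₁ · q) true) (true-xor (A₁ · q)) ⟩
    not (A₁ · q)        ≡⟨ sym (¬-not (λ α≡A₁·q → A₁·q≢α (sym α≡A₁·q))) ⟩
    α                   ∎)
    where
    shifted-sol : (M ⊛ (q ⊕ k₁)) ≐ (A₁ ∪ A₂)
    shifted-sol i =
      trans (*ᵥ-⊕ M q k₁ i) (trans (cong₂ _xor_ (q-sol i) (k₁-ker i)) (xor-identityʳ _))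

  toggled-solvable : ∀ α → Solvable M* (α ⋆ A₁ ⊕ not α ⋆ A₂)
  toggled-solvable α = p , λ i → begin
    (M* ⊛ p) i
      ≡⟨ M*-⊛ p i ⟩
    (M ⊛ p) i xor ((A₂ · p) ∧ A₁ i xor (A₁ · p) ∧ A₂ i)
      ≡⟨ cong₂ (λ u t → u xor (t ∧ A₁ i xor (A₁ · p) ∧ A₂ i))
               (trans (p-sol i) (∪≐⊕ i)) A₂·p≡not-α ⟩
    (A₁ i xor A₂ i) xor (not α ∧ A₁ i xor (A₁ · p) ∧ A₂ i)
      ≡⟨ cong (λ s → (A₁ i xor A₂ i) xor (not α ∧ A₁ i xor s ∧ A₂ i)) A₁·p≡α ⟩
    (A₁ i xor A₂ i) xor (not α ∧ A₁ i xor α ∧ A₂ i)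
      ≡⟨ swap-roles α (A₁ i) (A₂ i) ⟩
    α ∧ A₁ i xor not α ∧ A₂ i ∎
    where
    p = proj₁ (solution-with-A₁-dot α)
    p-sol = proj₁ (proj₂ (solution-with-A₁-dot α))
    A₁·p≡α = proj₂ (proj₂ (solution-with-A₁-dot α))
    A₂·p≡not-α : A₂ · p ≡ not α
    A₂·p≡not-α = trans (xor-move (trans (xor-comm (A₂ · p) _) (solution⇒dots-differ p-sol)))
                       (trans (true-xor (A₁ · p)) (cong not A₁·p≡α))
    swap-roles : ∀ β a b → (a xor b) xor (not β ∧ a xor β ∧ b) ≡ β ∧ a xor not β ∧ b
    swap-roles true  a b = trans (xor-cancelʳ a b) (sym (xor-identityʳ a))
    swap-roles false a b = trans (cong ((a xor b) xor_) (xor-identityʳ a)) (xor-cancelˡ a b)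

  toggled-AO₁ : AO M* A₁
  toggled-AO₁ =
    Product.map₂ (λ p-sol i → trans (p-sol i) (xor-identityʳ (A₁ i))) (toggled-solvable true) ,
    λ p M*p≐𝟏 → proj₁ (proj₂ (Equivalence.to (M*-constant-image true) M*p≐𝟏))

  toggled-AO₂ : AO M* A₂
  toggled-AO₂ =
    toggled-solvable false ,
    λ p M*p≐𝟏 → proj₂ (proj₂ (Equivalence.to (M*-constant-image true) M*p≐𝟏))

  nullity-drop : ∀ k → HasNullity M k → (1 ≤ k) × HasNullity M* (k ∸ 1)
  nullity-drop k (b , basis) =
    drop basis (basis-witness {P = λ v → (M ⊛ v) ≐ 𝟎} basis k₁-ker A₁·k₁)
    where
    drop : ∀ {k} {b : Fin k → Vec₂ n} → IsKerBasis M b → (∃ λ j → A₁ · b j ≡ true) →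
      (1 ≤ k) × HasNullity M* (k ∸ 1)
    drop {suc k} basis (j₀ , A₁·bⱼ₀) =
      s≤s z≤n , reduced , IsBasis-cong toggled-kernel reduced-basis
      where open KernelHyperplane basis A₁ j₀ A₁·bⱼ₀

N-symmetric : ∀ {n} (G : Graph n) → Symmetric (N G)
N-symmetric G i j = cong₂ _∨_ (⌊≟⌋-sym i j) (Graph.sym G i j)

N-unitDiagonal : ∀ {n} (G : Graph n) → UnitDiagonal (N G)
N-unitDiagonal G i = cong (_∨ adj G i i) (⌊≟⌋-refl i)

N*-entry : ∀ {n} (G : Graph n) {A₁ A₂ : Vec₂ n} → Disjoint A₁ A₂ →
  ∀ i j → N* G A₁ A₂ i j ≡ N G i j xor (A₁ i ∧ A₂ j xor A₂ i ∧ A₁ j)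
N*-entry G {A₁} {A₂} disjoint i j with i ≟ j
... | yes refl = sym (cong (true xor_)
                   (cong₂ _xor_ (disjoint i) (trans (∧-comm (A₂ i) (A₁ i)) (disjoint i))))
... | no _     = cong (adj G i j xor_) (∨≡xor (A₁ i ∧ A₂ j) (A₂ i ∧ A₁ j) (begin
  (A₁ i ∧ A₂ j) ∧ (A₂ i ∧ A₁ j)  ≡⟨ interchange (A₁ i) (A₂ j) (A₂ i) (A₁ j) ⟩
  (A₁ i ∧ A₂ i) ∧ (A₂ j ∧ A₁ j)  ≡⟨ cong (_∧ (A₂ j ∧ A₁ j)) (disjoint i) ⟩
  false                          ∎))
  where
  interchange : ∀ a b c d → (a ∧ b) ∧ (c ∧ d) ≡ (a ∧ c) ∧ (b ∧ d)
  interchange = solve-∀ Z₂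

mainTheorem18 : {n : ℕ} (G : Graph n) (A₁ A₂ : Vec₂ n) →
    Disjoint A₁ A₂ → HO (N G) A₁ → HO (N G) A₂ → AO (N G) (A₁ ∪ A₂) →
    (∀ p → ((N* G A₁ A₂ ⊛ p) ≐ 𝟏) ⇔
           (((N G ⊛ p) ≐ (‾ (A₁ ∪ A₂))) × ((A₁ · p) ≡ true) × ((A₂ · p) ≡ true)))
    × AO (N* G A₁ A₂) A₁ × AO (N* G A₁ A₂) A₂
    × (∀ k → HasNullity (N G) k → (1 ≤ k) × HasNullity (N* G A₁ A₂) (k ∸ 1))
mainTheorem18 G A₁ A₂ disjoint ho₁ ho₂ ao =
  (λ p → M*-constant-image true) , toggled-AO₁ , toggled-AO₂ , nullity-drop
  where
  open Toggle (N-symmetric G) (N-unitDiagonal G) {A₁} {A₂} disjoint ho₁ ho₂ ao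
              (N*-entry G {A₁} {A₂} disjoint)
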